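{- Let $\mathfrak{A}^o_N\subseteq\mathfrak{A}_N$ be the set of permutations all of whose cycles have odd length. Then $\mathfrak{A}^o_N$ is a lower ideal of $(\mathfrak{A}_N,\le_{\mathbf 3})$, and $\ell_{\mathbf 3}(x)=\ell_{\mathbf 2}(x)/2$ for every $x\in\mathfrak{A}^o_N$. Moreover, for $x,y\in\mathfrak{A}^o_N$, $y$ covers $x$ in $\le_{\mathbf 3}$ if and only if $x$ is obtained from $y$ by splitting an odd cycle of $y$ into three odd cycles of $x$.
   Context: $\mathfrak{S}_N$ is the symmetric group on $[N]$, $\mathfrak{A}_N$ the alternating group. Cycles of a permutation include fixed points (length $1$). $\ell_{\mathbf 2}(x)$ is the minimal number of transpositions with product $x$; for $x\in\mathfrak A_N$, $\ell_{\mathbf 3}(x)$ is the minimal number of $3$-cycles with product $x$, and $x\le_{\mathbf 3}y$ iff $\ell_{\mathbf 3}(y)=\ell_{\mathbf 3}(x)+\ell_{\mathbf 3}(x^{ -1}y)$. Joining $m$ disjoint cycles means choosing a starting element in each, concatenating the $m$ resulting sequences in some order and regarding the result as one cycle; splitting a cycle into $m$ cycles is the inverse operation. -}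

module Defs where

open import Data.Nat using (ℕ; zero; suc; _+_; _*_; _≤_; _<_)
open import Data.Fin using (Fin)
open import Data.Fin.Permutation
  using (Permutation′; _⟨$⟩ʳ_; _≈_; id; flip; _∘ₚ_; transpose)
open import Data.List using (List; []; _∷_; length; foldr)
open import Data.List.Relation.Unary.All using (All)
open import Data.Product using (Σ; ∃; ∃-syntax; _×_)
open import Relation.Binary.PropositionalEquality using (_≡_; _≢_)
open import Relation.Nullary using (¬_)

Perm : ℕ → Set
Perm N = Permutation′ N

Odd : ℕ → Set
Odd k = ∃[ m ] k ≡ suc (2 * m)

Even : ℕ → Set
Even k = ∃[ m ] k ≡ 2 * m

prod : ∀ {N} → List (Perm N) → Perm N
prod = foldr _∘ₚ_ id

IsTransposition : ∀ {N} → Perm N → Set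
IsTransposition {N} t = ∃[ i ] ∃[ j ] (i ≢ j × t ≈ transpose i j)

IsThreeCycle : ∀ {N} → Perm N → Set
IsThreeCycle {N} c =
  ∃[ i ] ∃[ j ] ∃[ k ]
    (i ≢ j × j ≢ k × i ≢ k
    × c ⟨$⟩ʳ i ≡ j × c ⟨$⟩ʳ j ≡ k × c ⟨$⟩ʳ k ≡ i
    × (∀ m → m ≢ i → m ≢ j → m ≢ k → c ⟨$⟩ʳ m ≡ m))

ProdTransp : ∀ {N} → Perm N → ℕ → Set
ProdTransp {N} x n =
  Σ (List (Perm N)) λ ts → All IsTransposition ts × length ts ≡ n × prod ts ≈ x

Prod3 : ∀ {N} → Perm N → ℕ → Set
Prod3 {N} x n =
  Σ (List (Perm N)) λ cs → All IsThreeCycle cs × length cs ≡ n × prod cs ≈ x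

IsL2 : ∀ {N} → Perm N → ℕ → Set
IsL2 x n = ProdTransp x n × (∀ m → ProdTransp x m → n ≤ m)

IsL3 : ∀ {N} → Perm N → ℕ → Set
IsL3 x n = Prod3 x n × (∀ m → Prod3 x m → n ≤ m)

InA : ∀ {N} → Perm N → Set
InA x = ∃[ n ] (ProdTransp x n × Even n)

iter : ∀ {N} → Perm N → ℕ → Fin N → Fin N
iter x zero i = i
iter x (suc k) i = x ⟨$⟩ʳ (iter x k i)

CycleLen : ∀ {N} → Perm N → Fin N → ℕ → Set
CycleLen x i k =
  1 ≤ k × iter x k i ≡ i × (∀ m → 1 ≤ m → m < k → iter x m i ≢ i)

SameCycle : ∀ {N} → Perm N → Fin N → Fin N → Set
SameCycle x i j = ∃[ k ] iter x k i ≡ j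

-- 𝔄^o_N : all cycles of x (including fixed points) have odd length
-- (such permutations are automatically even; we still require x ∈ 𝔄_N)
AllCyclesOdd : ∀ {N} → Perm N → Set
AllCyclesOdd x = ∀ i k → CycleLen x i k → Odd k

InAo : ∀ {N} → Perm N → Set
InAo x = InA x × AllCyclesOdd x

_≤₃_ : ∀ {N} → Perm N → Perm N → Set
x ≤₃ y = ∃[ a ] ∃[ b ] ∃[ c ]
  (IsL3 y a × IsL3 x b × IsL3 (y ∘ₚ flip x) c × a ≡ b + c)
-- note: (y ∘ₚ flip x) ⟨$⟩ʳ i = (flip x) ⟨$⟩ʳ (y ⟨$⟩ʳ i), i.e. the function x⁻¹ ∘ y

_<₃_ : ∀ {N} → Perm N → Perm N → Set
x <₃ y = x ≤₃ y × ¬ (x ≈ y)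

Covers : ∀ {N} → Perm N → Perm N → Set
Covers {N} y x = x <₃ y × (∀ (z : Perm N) → InA z → x <₃ z → ¬ (z <₃ y))

-- y is obtained from x by joining three disjoint cycles of x, the cycles of
-- a, b, c, taking a, b, c as the starting elements and concatenating in the
-- order a, b, c: the joined cycle is
--   (a, x a, …, x⁻¹ a, b, x b, …, x⁻¹ b, c, x c, …, x⁻¹ c),
-- so y sends x⁻¹ a ↦ b, x⁻¹ b ↦ c, x⁻¹ c ↦ a and agrees with x elsewhere.
-- (All orders of concatenation are covered by quantifying over a, b, c.)
JoinOf3 : ∀ {N} → Perm N → Fin N → Fin N → Fin N → Perm N → Set
JoinOf3 x a b c y =
  ¬ SameCycle x a b × ¬ SameCycle x b c × ¬ SameCycle x a c
  × y ⟨$⟩ʳ (flip x ⟨$⟩ʳ a) ≡ b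
  × y ⟨$⟩ʳ (flip x ⟨$⟩ʳ b) ≡ c
  × y ⟨$⟩ʳ (flip x ⟨$⟩ʳ c) ≡ a
  × (∀ m → m ≢ flip x ⟨$⟩ʳ a → m ≢ flip x ⟨$⟩ʳ b → m ≢ flip x ⟨$⟩ʳ c
         → y ⟨$⟩ʳ m ≡ x ⟨$⟩ʳ m)

-- x is obtained from y by splitting an odd cycle of y into three odd cycles
-- of x (equivalently y is obtained from x by joining three odd cycles of x;
-- the joined cycle of y then has odd length, which we also state)
SplitOdd3 : ∀ {N} → Perm N → Perm N → Set
SplitOdd3 x y = ∃[ a ] ∃[ b ] ∃[ c ]
  (JoinOf3 x a b c y
  × (∃[ p ] (CycleLen x a p × Odd p))
  × (∃[ q ] (CycleLen x b q × Odd q))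
  × (∃[ r ] (CycleLen x c r × Odd r))
  × (∃[ s ] (CycleLen y a s × Odd s)))

-- Let c(x) be the number of cycles of x, fixed points included. Composing with a transposition
-- changes c by at most 1 and composing with a 3-cycle by at most 2, so N ≤ c(x) + ℓ₂(x) and
-- N ≤ c(x) + 2ℓ₃(x). A 3-cycle (u v w) lowers c by exactly 2 precisely when u, v, w lie on three
-- different cycles, which it joins into one cycle whose length is the sum of theirs. If all cycles
-- of x are odd, x is such a join of a permutation with odd cycles (split (i, x i, x² i) off a
-- nontrivial cycle), so by induction both bounds are attained: ℓ₃ = (N − c)/2 and ℓ₂ = N − c.
-- If x ≤₃ y with y in 𝔄ᵒ, minimal factorisations of x⁻¹y and x concatenate to a factorisation of y
-- attaining the bound, so every 3-cycle in it is a join, and x, a partial product, has odd cycles.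
-- For x, y in 𝔄ᵒ the formula gives ℓ₃ y = ℓ₃ x + 1 exactly when c(x) = c(y) + 2, so a cover is a
-- single 3-cycle joining three cycles of x; when x⁻¹y needs two or more 3-cycles, dropping one
-- produces a permutation strictly between x and y.

module Submission where

open import Defs
open import Data.Bool using (Bool; true; false; T; not; _∧_; if_then_else_)
open import Data.Bool.ListAction using (any)
open import Data.Bool.Properties using (∧-assoc; ∧-identityʳ; ∧-zeroʳ; T-∧)
open import Data.Empty using (⊥-elim)
open import Data.Fin using (Fin; zero; suc; toℕ; fromℕ<; _≟_) renaming (_<_ to _<ᶠ_; _<?_ to _<ᶠ?_)
open import Data.Fin.Induction using () renaming (<-wellFounded to <ᶠ-wellFounded)
open import Data.Fin.Permutation using (_⟨$⟩ʳ_; _⟨$⟩ˡ_; _∘ₚ_; flip; id; transpose; inverseʳ; inverseˡ) renaming (_≈_ to _≈ₚ_)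
open import Data.Fin.Properties using (all?; any?; pigeonhole; toℕ<n; toℕ-fromℕ<; suc-injective)
  renaming (<-cmp to <ᶠ-cmp; <-irrefl to <ᶠ-irrefl)
open import Data.List using (List; []; _∷_; length; map; _++_)
open import Data.List.Membership.Propositional using (_∈_; _∉_; find)
open import Data.List.Properties using (length-map; length-++)
open import Data.List.Relation.Unary.All using (All; []; _∷_)
import Data.List.Relation.Unary.All as All
import Data.List.Relation.Unary.All.Properties as Allₚ
open import Data.List.Relation.Unary.AllPairs using (AllPairs; []; _∷_)
import Data.List.Relation.Unary.AllPairs as AllPairs
import Data.List.Relation.Unary.AllPairs.Properties as AllPairsₚ
open import Data.List.Relation.Unary.Any using (Any; here; there)
import Data.List.Relation.Unary.Any as Any
open import Data.List.Relation.Unary.Any.Properties using (any⁺; any⁻; ¬Any[])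
open import Data.Nat using (ℕ; zero; suc; _+_; _*_; _∸_; _≤_; _<_; z≤n; s≤s; s≤s⁻¹; _≤?_; _%_; _/_)
open import Data.Nat.DivMod using (m≡m%n+[m/n]*n; m%n<n)
open import Data.Nat.Induction using (<-wellFounded)
open import Data.Nat.Properties
  using (≤-refl; ≤-reflexive; ≤-trans; ≤-antisym; ≤-pred; <-irrefl; <-cmp; <⇒≤; ≰⇒>; n<1+n; n≤1+n; 1+n≰n; n≤0⇒n≡0;
         m≤m+n; m≤n⇒m≤1+n; m≤n⇒∃[o]m+o≡n; m∸n+n≡m; m+[n∸m]≡n; even≢odd;
         +-comm; +-assoc; +-suc; +-identityʳ; +-mono-≤; +-monoˡ-≤; +-monoʳ-≤;
         +-cancelˡ-≡; +-cancelʳ-≡; +-cancelˡ-≤; +-cancelʳ-≤; +-cancelʳ-<; *-suc; *-zeroʳ; *-identityˡ; *-cancelˡ-≡; *-cancelˡ-≤;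
         +-commutativeSemigroup; module ≤-Reasoning)
open import Algebra.Properties.CommutativeSemigroup +-commutativeSemigroup using (interchange)
open import Data.Nat.Solver using (module +-*-Solver)
open import Data.Product using (Σ; ∃-syntax; _×_; _,_; proj₁; proj₂)
open import Data.Sum using (_⊎_; inj₁; inj₂)
open import Function using (_∘_)
open import Function.Bundles using (Equivalence; _⇔_; mk⇔)
open import Induction.WellFounded using (Acc; acc)
open import Level using (0ℓ)
open import Relation.Binary using (Rel; Decidable; Reflexive; Symmetric; Transitive; tri<; tri≈; tri>)
open import Relation.Binary.PropositionalEquality
open import Relation.Nullary using (¬_; Dec; yes; no; contradiction)
open import Relation.Nullary.Decidable
  using (⌊_⌋; _×-dec_; _→-dec_; ¬?; toWitness; fromWitness; toWitnessFalse; fromWitnessFalse; isYes≗does; does-⇔; dec-true; dec-false; decidable-stable; map′)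
open +-*-Solver using (solve; _:+_; _:*_; _:=_; con)

-- Counting

indicator : Bool → ℕ
indicator b = if b then 1 else 0

count : ∀ {N} → (Fin N → Bool) → ℕ
count {zero}  f = 0
count {suc N} f = indicator (f zero) + count (f ∘ suc)

count-cong : ∀ {N} {f g : Fin N → Bool} → (∀ i → f i ≡ g i) → count f ≡ count g
count-cong {zero}  f≗g = refl
count-cong {suc N} f≗g = cong₂ _+_ (cong indicator (f≗g zero)) (count-cong (f≗g ∘ suc))

count-split : ∀ {N} (f s : Fin N → Bool) →
  count f ≡ count (λ i → f i ∧ s i) + count (λ i → f i ∧ not (s i))
count-split {zero}  f s = refl
count-split {suc N} f s =
  begin
    indicator (f zero) + count (f ∘ suc)
  ≡⟨ cong₂ _+_ (split (f zero) (s zero)) (count-split (f ∘ suc) (s ∘ suc)) ⟩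
    (a + b) + (c + d)
  ≡⟨ interchange a b c d ⟩
    (a + c) + (b + d)
  ∎
  where
  open ≡-Reasoning
  a = indicator (f zero ∧ s zero)
  b = indicator (f zero ∧ not (s zero))
  c = count (λ i → f (suc i) ∧ s (suc i))
  d = count (λ i → f (suc i) ∧ not (s (suc i)))
  split : ∀ p q → indicator p ≡ indicator (p ∧ q) + indicator (p ∧ not q)
  split true  true  = refl
  split true  false = refl
  split false q     = refl

count≤size : ∀ {N} (f : Fin N → Bool) → count f ≤ N
count≤size {zero}  f = z≤n
count≤size {suc N} f with f zero
... | true  = s≤s (count≤size (f ∘ suc))
... | false = m≤n⇒m≤1+n (count≤size (f ∘ suc))

count-all : ∀ {N} (f : Fin N → Bool) → (∀ i → T (f i)) → count f ≡ N
count-all {zero}  f all = refl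
count-all {suc N} f all with f zero | all zero
... | true | _ = cong suc (count-all (f ∘ suc) (all ∘ suc))

count-none : ∀ {N} (f : Fin N → Bool) → (∀ i → ¬ T (f i)) → count f ≡ 0
count-none {zero}  f none = refl
count-none {suc N} f none with f zero | none zero
... | false | _   = count-none (f ∘ suc) (none ∘ suc)
... | true  | ¬f₀ = ⊥-elim (¬f₀ _)

count-unique : ∀ {N} (f : Fin N → Bool) → (∀ i j → T (f i) → T (f j) → i ≡ j) → count f ≤ 1
count-unique {zero}  f unique = z≤n
count-unique {suc N} f unique with f zero in f₀
... | false = count-unique (f ∘ suc) (λ i j fi fj → suc-injective (unique (suc i) (suc j) fi fj))
... | true  = s≤s (≤-reflexive (count-none (f ∘ suc) (λ i fi → 0≢suc (unique zero (suc i) (subst T (sym f₀) _) fi))))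
  where
  0≢suc : ∀ {i : Fin N} → zero ≢ suc i
  0≢suc ()

_≢ᵇ_ : ∀ {N} → Fin N → Fin N → Bool
i ≢ᵇ a = not ⌊ i ≟ a ⌋

count-remove : ∀ {N} (f : Fin N → Bool) {a} → T (f a) → count f ≡ suc (count (λ i → f i ∧ i ≢ᵇ a))
count-remove {suc N} f {zero} fa with f zero
... | true = cong suc (count-cong (λ i → sym (∧-identityʳ (f (suc i)))))
count-remove {suc N} f {suc a} fa =
  begin
    indicator (f zero) + count (f ∘ suc)
  ≡⟨ cong (indicator (f zero) +_) (count-remove (f ∘ suc) fa) ⟩
    indicator (f zero) + suc (count (λ i → f (suc i) ∧ i ≢ᵇ a))
  ≡⟨ +-suc _ _ ⟩
    suc (indicator (f zero) + count (λ i → f (suc i) ∧ i ≢ᵇ a))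
  ≡⟨ cong suc (cong₂ _+_ (cong indicator (sym (∧-identityʳ (f zero)))) (count-cong shift)) ⟩
    suc (count (λ i → f i ∧ i ≢ᵇ suc a))
  ∎
  where
  open ≡-Reasoning
  shift : ∀ i → f (suc i) ∧ i ≢ᵇ a ≡ f (suc i) ∧ suc i ≢ᵇ suc a
  shift i with i ≟ a
  ... | yes _ = refl
  ... | no _  = refl

count≥length : ∀ {N} (f : Fin N → Bool) {is} → AllPairs _≢_ is → All (T ∘ f) is → length is ≤ count f
count≥length f []                    []          = z≤n
count≥length f {i ∷ is} (i≢is ∷ distinct) (fi ∷ fis) =
  subst (suc (length is) ≤_) (sym (count-remove f fi))
    (s≤s (count≥length (λ k → f k ∧ k ≢ᵇ i) distinct (All.zipWith still-in (i≢is , fis))))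
  where
  still-in : ∀ {k} → i ≢ k × T (f k) → T (f k ∧ k ≢ᵇ i)
  still-in (i≢k , fk) = Equivalence.from T-∧ (fk , fromWitnessFalse (i≢k ∘ sym))

∧-not-cong : ∀ {a b} s → (¬ T s → a ≡ b) → a ∧ not s ≡ b ∧ not s
∧-not-cong {a} {b} true  _   = trans (∧-zeroʳ a) (sym (∧-zeroʳ b))
∧-not-cong         false a≡b = cong (_∧ true) (a≡b (λ ()))

even-or-odd : ∀ n → Even n ⊎ Odd n
even-or-odd zero = inj₁ (0 , refl)
even-or-odd (suc n) with even-or-odd n
... | inj₁ (m , refl) = inj₂ (m , refl)
... | inj₂ (m , refl) = inj₁ (suc m , cong suc (sym (+-suc m (m + 0))))

odd+odd+odd : ∀ {a b c} → Odd a → Odd b → Odd c → Odd (a + (b + c))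
odd+odd+odd (i , refl) (j , refl) (k , refl) = suc (i + j + k) ,
  solve 3 (λ i j k → (con 1 :+ con 2 :* i) :+ ((con 1 :+ con 2 :* j) :+ (con 1 :+ con 2 :* k))
                     := con 1 :+ con 2 :* (con 1 :+ i :+ j :+ k)) refl i j k

odd+odd+odd-cancelʳ : ∀ {a b c} → Odd (a + (b + c)) → Odd b → Odd c → Odd a
odd+odd+odd-cancelʳ {a} (n , sum≡) (j , refl) (k , refl) with even-or-odd a
... | inj₂ odd = odd
... | inj₁ (i , refl) = contradiction (trans (regroup i j k) sum≡) (even≢odd (suc (i + j + k)) n)
  where
  regroup : ∀ i j k → 2 * suc (i + j + k) ≡ 2 * i + (suc (2 * j) + suc (2 * k))
  regroup = solve 3 (λ i j k → con 2 :* (con 1 :+ i :+ j :+ k)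
                     := con 2 :* i :+ ((con 1 :+ con 2 :* j) :+ (con 1 :+ con 2 :* k))) refl

-- Equivalence classes are counted through their least elements.
module Leaders {N : ℕ} {R : Rel (Fin N) 0ℓ} (R? : Decidable R)
  (R-refl : Reflexive R) (R-sym : Symmetric R) (R-trans : Transitive R) where

  IsLeader : Fin N → Set
  IsLeader i = ∀ j → j <ᶠ i → ¬ R i j

  isLeader? : ∀ i → Dec (IsLeader i)
  isLeader? i = all? (λ j → (j <ᶠ? i) →-dec ¬? (R? i j))

  isLeader : Fin N → Bool
  isLeader i = ⌊ isLeader? i ⌋

  leader-unique : ∀ {a b} → IsLeader a → IsLeader b → R a b → a ≡ b
  leader-unique {a} {b} la lb Rab with <ᶠ-cmp a b
  ... | tri< a<b _ _ = ⊥-elim (lb a a<b (R-sym Rab))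
  ... | tri≈ _ a≡b _ = a≡b
  ... | tri> _ _ b<a = ⊥-elim (la b b<a Rab)

  leaderOf : ∀ i → ∃[ m ] (R i m × IsLeader m)
  leaderOf i = go i (<ᶠ-wellFounded i)
    where
    go : ∀ i → Acc _<ᶠ_ i → ∃[ m ] (R i m × IsLeader m)
    go i (acc smaller) with isLeader? i | any? (λ j → (j <ᶠ? i) ×-dec R? i j)
    ... | yes leader | _                   = i , R-refl , leader
    ... | no _       | yes (j , j<i , Rij) = let m , Rjm , leader = go j (smaller j<i) in m , R-trans Rij Rjm , leader
    ... | no ¬leader | no none             = ⊥-elim (¬leader (λ j j<i Rij → none (j , j<i , Rij)))

  leadersIn : (Fin N → Bool) → ℕ
  leadersIn S = count (λ i → isLeader i ∧ S i)

  leadersIn≤length : ∀ (S : Fin N → Bool) gs → (∀ m → T (S m) → Any (λ g → R g m) gs) →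
                     leadersIn S ≤ length gs
  leadersIn≤length S []       covered =
    ≤-reflexive (count-none _ (λ m L∧S → ¬Any[] (covered m (proj₂ (Equivalence.to (T-∧ {isLeader m}) L∧S)))))
  leadersIn≤length S (g ∷ gs) covered =
    begin
      leadersIn S
    ≡⟨ count-split (λ i → isLeader i ∧ S i) (Rg) ⟩
      count (λ i → (isLeader i ∧ S i) ∧ Rg i) + count (λ i → (isLeader i ∧ S i) ∧ not (Rg i))
    ≡⟨ cong (count (λ i → (isLeader i ∧ S i) ∧ Rg i) +_) (count-cong (λ i → ∧-assoc (isLeader i) (S i) _)) ⟩
      count (λ i → (isLeader i ∧ S i) ∧ Rg i) + leadersIn S′
    ≤⟨ +-mono-≤ (count-unique _ sameLeader) (leadersIn≤length S′ gs covered′) ⟩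
      1 + length gs
    ∎
    where
    open ≤-Reasoning
    Rg : Fin N → Bool
    Rg m = ⌊ R? g m ⌋
    S′ : Fin N → Bool
    S′ m = S m ∧ not (Rg m)
    unpack : ∀ i → T ((isLeader i ∧ S i) ∧ Rg i) → IsLeader i × R g i
    unpack i t = let L∧S , Rgi = Equivalence.to (T-∧ {isLeader i ∧ S i}) t
                 in toWitness (proj₁ (Equivalence.to (T-∧ {isLeader i}) L∧S)) , toWitness Rgi
    sameLeader : ∀ i j → T ((isLeader i ∧ S i) ∧ Rg i) → T ((isLeader j ∧ S j) ∧ Rg j) → i ≡ j
    sameLeader i j ti tj with unpack i ti | unpack j tj
    ... | Li , Rgi | Lj , Rgj = leader-unique Li Lj (R-trans (R-sym Rgi) Rgj)
    covered′ : ∀ m → T (S′ m) → Any (λ g → R g m) gs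
    covered′ m t with Equivalence.to (T-∧ {S m}) t
    ... | Sm , ¬Rgm with covered m Sm
    ...   | here Rgm = ⊥-elim (toWitnessFalse ¬Rgm Rgm)
    ...   | there Rg′m = Rg′m

  Closed : (Fin N → Bool) → Set
  Closed S = ∀ {i j} → T (S i) → R i j → T (S j)

  length≤leadersIn : ∀ (S : Fin N → Bool) → Closed S → ∀ {gs} →
                     AllPairs (λ a b → ¬ R a b) gs → All (T ∘ S) gs → length gs ≤ leadersIn S
  length≤leadersIn S closed {gs} apart inS =
    subst (_≤ leadersIn S) (length-map leader gs)
      (count≥length _ (AllPairsₚ.map⁺ (AllPairs.map distinctLeaders apart)) (Allₚ.map⁺ (All.map leaderIn inS)))
    where
    leader : Fin N → Fin N
    leader = proj₁ ∘ leaderOf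
    distinctLeaders : ∀ {a b} → ¬ R a b → leader a ≢ leader b
    distinctLeaders {a} {b} ¬Rab eq =
      ¬Rab (R-trans (proj₁ (proj₂ (leaderOf a))) (subst (λ m → R m b) (sym eq) (R-sym (proj₁ (proj₂ (leaderOf b))))))
    leaderIn : ∀ {a} → T (S a) → T (isLeader (leader a) ∧ S (leader a))
    leaderIn {a} Sa = let _ , Ram , Lm = leaderOf a in Equivalence.from T-∧ (fromWitness Lm , closed Sa Ram)

-- Cycles of a permutation

module _ {N : ℕ} (x : Perm N) where

  ⟨$⟩ʳ-injective : ∀ {i j} → x ⟨$⟩ʳ i ≡ x ⟨$⟩ʳ j → i ≡ j
  ⟨$⟩ʳ-injective {i} {j} eq = trans (sym (inverseˡ x)) (trans (cong (x ⟨$⟩ˡ_) eq) (inverseˡ x))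

  iter-+ : ∀ m n i → iter x (m + n) i ≡ iter x m (iter x n i)
  iter-+ zero    n i = refl
  iter-+ (suc m) n i = cong (x ⟨$⟩ʳ_) (iter-+ m n i)

  iter-comm : ∀ m n i → iter x m (iter x n i) ≡ iter x n (iter x m i)
  iter-comm m n i = trans (sym (iter-+ m n i)) (trans (cong (λ k → iter x k i) (+-comm m n)) (iter-+ n m i))

  iter-injective : ∀ k {i j} → iter x k i ≡ iter x k j → i ≡ j
  iter-injective zero    eq = eq
  iter-injective (suc k) eq = iter-injective k (⟨$⟩ʳ-injective eq)

  iter-*-period : ∀ {p i} → iter x p i ≡ i → ∀ q → iter x (q * p) i ≡ i
  iter-*-period          ret zero    = refl
  iter-*-period {p} {i} ret (suc q) = trans (iter-+ p (q * p) i) (trans (cong (iter x p) (iter-*-period ret q)) ret)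

  returns : ∀ i → ∃[ p ] (1 ≤ p × iter x p i ≡ i)
  returns i with pigeonhole (n<1+n N) (λ (k : Fin (suc N)) → iter x (toℕ k) i)
  ... | a , b , a<b , eq with m≤n⇒∃[o]m+o≡n (<⇒≤ a<b)
  ...   | zero , a+0≡b = ⊥-elim (<-irrefl (trans (sym (+-comm (toℕ a) 0)) a+0≡b) a<b)
  ...   | suc d , a+d≡b =
    suc d , s≤s z≤n ,
    iter-injective (toℕ a) (trans (sym (iter-+ (toℕ a) (suc d) i)) (trans (cong (λ k → iter x k i) a+d≡b) (sym eq)))

  cycleLength : ∀ i → ∃[ L ] CycleLen x i L
  cycleLength i = let p , p≥1 , ret = returns i in shortest p (<-wellFounded p) p≥1 ret
    where
    shortest : ∀ p → Acc _<_ p → 1 ≤ p → iter x p i ≡ i → ∃[ L ] CycleLen x i L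
    shortest p (acc smaller) p≥1 ret with any? (λ (m : Fin p) → (1 ≤? toℕ m) ×-dec (iter x (toℕ m) i ≟ i))
    ... | yes (m , m≥1 , ret′) = shortest (toℕ m) (smaller (toℕ<n m)) m≥1 ret′
    ... | no none = p , p≥1 , ret , λ m m≥1 m<p ret′ →
      none (fromℕ< m<p , subst (1 ≤_) (sym (toℕ-fromℕ< m<p)) m≥1 , subst (λ k → iter x k i ≡ i) (sym (toℕ-fromℕ< m<p)) ret′)

  cycleLen-unique : ∀ {i L L′} → CycleLen x i L → CycleLen x i L′ → L ≡ L′
  cycleLen-unique {i} {L} {L′} (L≥1 , ret , first) (L′≥1 , ret′ , first′) with <-cmp L L′
  ... | tri< L<L′ _ _ = ⊥-elim (first′ L L≥1 L<L′ ret)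
  ... | tri≈ _ L≡L′ _ = L≡L′
  ... | tri> _ _ L′<L = ⊥-elim (first L′ L′≥1 L′<L ret′)

  iter-mod : ∀ {i L} → CycleLen x i L → ∀ k → ∃[ r ] (r < L × iter x k i ≡ iter x r i)
  iter-mod {i} {L@(suc _)} (_ , ret , _) k = k % L , m%n<n k L ,
    (begin
      iter x k i                              ≡⟨ cong (λ n → iter x n i) (m≡m%n+[m/n]*n k L) ⟩
      iter x (k % L + (k / L) * L) i          ≡⟨ iter-+ (k % L) ((k / L) * L) i ⟩
      iter x (k % L) (iter x ((k / L) * L) i) ≡⟨ cong (iter x (k % L)) (iter-*-period ret (k / L)) ⟩
      iter x (k % L) i                        ∎)
    where open ≡-Reasoning

  sameCycle-refl : ∀ {i} → SameCycle x i i
  sameCycle-refl = 0 , refl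

  sameCycle-step : ∀ i → SameCycle x i (x ⟨$⟩ʳ i)
  sameCycle-step i = 1 , refl

  sameCycle-trans : ∀ {i j k} → SameCycle x i j → SameCycle x j k → SameCycle x i k
  sameCycle-trans {i} (m , refl) (n , refl) = n + m , iter-+ n m i

  sameCycle-within : ∀ {i j L} → CycleLen x i L → SameCycle x i j → ∃[ n ] (n < L × iter x n i ≡ j)
  sameCycle-within len (k , refl) = let r , r<L , eq = iter-mod len k in r , r<L , sym eq

  sameCycle-sym : ∀ {i j} → SameCycle x i j → SameCycle x j i
  sameCycle-sym {i} ij with cycleLength i
  ... | L , len@(_ , ret , _) with sameCycle-within len ij
  ...   | r , r<L , refl = L ∸ r ,
    (begin
      iter x (L ∸ r) (iter x r i) ≡⟨ sym (iter-+ (L ∸ r) r i) ⟩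
      iter x (L ∸ r + r) i        ≡⟨ cong (λ n → iter x n i) (m∸n+n≡m (<⇒≤ r<L)) ⟩
      iter x L i                  ≡⟨ ret ⟩
      i                           ∎)
    where open ≡-Reasoning

  sameCycle? : ∀ i j → Dec (SameCycle x i j)
  sameCycle? i j with cycleLength i
  ... | L , len = map′ (λ (k , eq) → toℕ k , eq) within (any? (λ (k : Fin L) → iter x (toℕ k) i ≟ j))
    where
    within : SameCycle x i j → ∃[ k ] iter x (toℕ {L} k) i ≡ j
    within ij = let n , n<L , eq = sameCycle-within len ij in
      fromℕ< n<L , subst (λ m → iter x m i ≡ j) (sym (toℕ-fromℕ< n<L)) eq

  cycleLen-sameCycle : ∀ {i j L} → SameCycle x i j → CycleLen x i L → CycleLen x j L
  cycleLen-sameCycle {i} {L = L} (t , refl) (L≥1 , ret , first) =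
    L≥1 , trans (iter-comm L t i) (cong (iter x t) ret) ,
    λ m m≥1 m<L ret′ → first m m≥1 m<L (iter-injective t (trans (iter-comm t m i) ret′))

  fixed-iter : ∀ {i} → x ⟨$⟩ʳ i ≡ i → ∀ k → iter x k i ≡ i
  fixed-iter fix zero    = refl
  fixed-iter fix (suc k) = trans (cong (x ⟨$⟩ʳ_) (fixed-iter fix k)) fix

  fixed-sameCycle : ∀ {i j} → x ⟨$⟩ʳ i ≡ i → SameCycle x i j → j ≡ i
  fixed-sameCycle fix (k , refl) = fixed-iter fix k

  fixed-cycleLen : ∀ {i} → x ⟨$⟩ʳ i ≡ i → CycleLen x i 1
  fixed-cycleLen fix = ≤-refl , fix , λ { m m≥1 (s≤s m≤0) → ⊥-elim (<-irrefl (sym (n≤0⇒n≡0 m≤0)) m≥1) }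

module _ {N : ℕ} {a b : Perm N} {i : Fin N} where

  orbit-agree : (∀ k → a ⟨$⟩ʳ iter a k i ≡ b ⟨$⟩ʳ iter a k i) → ∀ k → iter a k i ≡ iter b k i
  orbit-agree agree zero    = refl
  orbit-agree agree (suc k) = trans (agree k) (cong (b ⟨$⟩ʳ_) (orbit-agree agree k))

  module _ (same : ∀ k → iter a k i ≡ iter b k i) where

    sameCycle-orbit : ∀ {j} → SameCycle a i j → SameCycle b i j
    sameCycle-orbit (k , eq) = k , trans (sym (same k)) eq

    cycleLen-orbit : ∀ {L} → CycleLen a i L → CycleLen b i L
    cycleLen-orbit {L} (L≥1 , ret , first) =
      L≥1 , trans (sym (same L)) ret , λ m m≥1 m<L ret′ → first m m≥1 m<L (trans (same m) ret′)

iter-≈ : ∀ {N} {a b : Perm N} → a ≈ₚ b → ∀ {i} k → iter a k i ≡ iter b k i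
iter-≈ a≈b = orbit-agree (λ _ → a≈b _)

iter-redirect : ∀ {N} (x y : Perm N) {a b L} → y ⟨$⟩ʳ a ≡ x ⟨$⟩ʳ b →
  (∀ n → 1 ≤ n → n < L → y ⟨$⟩ʳ iter x n b ≡ x ⟨$⟩ʳ iter x n b) →
  ∀ n → 1 ≤ n → n ≤ L → iter y n a ≡ iter x n b
iter-redirect x y ya≡xb agree 1             _ _   = ya≡xb
iter-redirect x y ya≡xb agree (suc (suc n)) _ n<L =
  trans (cong (y ⟨$⟩ʳ_) (iter-redirect x y ya≡xb agree (suc n) (s≤s z≤n) (≤-trans (n≤1+n _) n<L)))
        (agree (suc n) (s≤s z≤n) n<L)

≰⇒∃+ : ∀ {m k} → ¬ m ≤ k → ∃[ n ] (1 ≤ n × m ≡ n + k)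
≰⇒∃+ {m} {k} m≰k with m≤n⇒∃[o]m+o≡n (≰⇒> m≰k)
... | o , k+o≡m = suc o , s≤s z≤n , trans (sym k+o≡m) (cong suc (+-comm k o))

-- Transpositions and 3-cycles

module _ {N : ℕ} where

  transpose-left : ∀ (i j : Fin N) → transpose i j ⟨$⟩ʳ i ≡ j
  transpose-left i j rewrite dec-true (i ≟ i) refl = refl

  transpose-right : ∀ (i j : Fin N) → transpose i j ⟨$⟩ʳ j ≡ i
  transpose-right i j with j ≟ i
  ... | yes j≡i = j≡i
  ... | no  j≢i rewrite dec-true (j ≟ j) refl = refl

  transpose-other : ∀ (i j k : Fin N) → k ≢ i → k ≢ j → transpose i j ⟨$⟩ʳ k ≡ k
  transpose-other i j k k≢i k≢j rewrite dec-false (k ≟ i) k≢i | dec-false (k ≟ j) k≢j = refl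

  threeCycle : Fin N → Fin N → Fin N → Perm N
  threeCycle u v w = transpose u v ∘ₚ transpose u w

  module _ {u v w : Fin N} (u≢v : u ≢ v) (v≢w : v ≢ w) (u≢w : u ≢ w) where

    threeCycle-u : threeCycle u v w ⟨$⟩ʳ u ≡ v
    threeCycle-u rewrite transpose-left u v = transpose-other u w v (u≢v ∘ sym) v≢w

    threeCycle-v : threeCycle u v w ⟨$⟩ʳ v ≡ w
    threeCycle-v rewrite transpose-right u v = transpose-left u w

    threeCycle-w : threeCycle u v w ⟨$⟩ʳ w ≡ u
    threeCycle-w rewrite transpose-other u v w (u≢w ∘ sym) (v≢w ∘ sym) = transpose-right u w

    threeCycle-other : ∀ m → m ≢ u → m ≢ v → m ≢ w → threeCycle u v w ⟨$⟩ʳ m ≡ m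
    threeCycle-other m m≢u m≢v m≢w rewrite transpose-other u v m m≢u m≢v = transpose-other u w m m≢u m≢w

    isThreeCycle-threeCycle : IsThreeCycle (threeCycle u v w)
    isThreeCycle-threeCycle = u , v , w , u≢v , v≢w , u≢w , threeCycle-u , threeCycle-v , threeCycle-w , threeCycle-other

  ≡-or-≢₃ : ∀ (m u v w : Fin N) → m ≡ u ⊎ m ≡ v ⊎ m ≡ w ⊎ (m ≢ u × m ≢ v × m ≢ w)
  ≡-or-≢₃ m u v w with m ≟ u | m ≟ v | m ≟ w
  ... | yes m≡u | _       | _       = inj₁ m≡u
  ... | no _    | yes m≡v | _       = inj₂ (inj₁ m≡v)
  ... | no _    | no _    | yes m≡w = inj₂ (inj₂ (inj₁ m≡w))
  ... | no m≢u  | no m≢v  | no m≢w  = inj₂ (inj₂ (inj₂ (m≢u , m≢v , m≢w)))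

  isThreeCycle-≈ : ∀ {c} → ((u , v , w , _) : IsThreeCycle c) → c ≈ₚ threeCycle u v w
  isThreeCycle-≈ (u , v , w , u≢v , v≢w , u≢w , cu , cv , cw , c-other) m with ≡-or-≢₃ m u v w
  ... | inj₁ refl                = trans cu (sym (threeCycle-u u≢v v≢w u≢w))
  ... | inj₂ (inj₁ refl)         = trans cv (sym (threeCycle-v u≢v v≢w u≢w))
  ... | inj₂ (inj₂ (inj₁ refl))  = trans cw (sym (threeCycle-w u≢v v≢w u≢w))
  ... | inj₂ (inj₂ (inj₂ (m≢u , m≢v , m≢w))) =
    trans (c-other m m≢u m≢v m≢w) (sym (threeCycle-other u≢v v≢w u≢w m m≢u m≢v m≢w))

-- The number of cycles

swap-ends : ∀ a b c → (a + b) + c ≡ (c + b) + a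
swap-ends = solve 3 (λ a b c → (a :+ b) :+ c := (c :+ b) :+ a) refl

module CycleLeaders {N : ℕ} (x : Perm N) =
  Leaders (sameCycle? x) (sameCycle-refl x) (sameCycle-sym x) (sameCycle-trans x)

cyclesIn : ∀ {N} → Perm N → (Fin N → Bool) → ℕ
cyclesIn x = CycleLeaders.leadersIn x

-- Opaque so that unification compares cycle counts instead of unfolding them into the
-- decision procedures behind `isLeader`.
opaque
  cycles : ∀ {N} → Perm N → ℕ
  cycles x = count (CycleLeaders.isLeader x)

  cycles-split : ∀ {N} (x : Perm N) S → cycles x ≡ cyclesIn x S + count (λ i → CycleLeaders.isLeader x i ∧ not (S i))
  cycles-split x S = count-split (CycleLeaders.isLeader x) S

  cycles≤size : ∀ {N} (x : Perm N) → cycles x ≤ N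
  cycles≤size x = count≤size _

  cycles-fixed : ∀ {N} (x : Perm N) → (∀ i → x ⟨$⟩ʳ i ≡ i) → cycles x ≡ N
  cycles-fixed x fixed = count-all _ (λ i → fromWitness (λ j j<i xij → <ᶠ-irrefl (fixed-sameCycle x (fixed i) xij) j<i))

module _ {N : ℕ} (x y : Perm N) (S : Fin N → Bool) (closed : CycleLeaders.Closed x S)
         (agree : ∀ i → ¬ T (S i) → y ⟨$⟩ʳ i ≡ x ⟨$⟩ʳ i) where

  private
    outside-orbit : ∀ {i} → ¬ T (S i) → ∀ k → ¬ T (S (iter x k i))
    outside-orbit ¬Si k Sk = ¬Si (closed Sk (sameCycle-sym x (k , refl)))

    orbits-agree : ∀ {i} → ¬ T (S i) → ∀ k → iter x k i ≡ iter y k i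
    orbits-agree ¬Si = orbit-agree (λ k → sym (agree _ (outside-orbit ¬Si k)))

    x⇒y : ∀ {i j} → ¬ T (S i) → SameCycle x i j → SameCycle y i j
    x⇒y ¬Si = sameCycle-orbit (orbits-agree ¬Si)

    y⇒x : ∀ {i j} → ¬ T (S i) → SameCycle y i j → SameCycle x i j
    y⇒x ¬Si = sameCycle-orbit (λ k → sym (orbits-agree ¬Si k))

  closed-under-both : CycleLeaders.Closed y S
  closed-under-both {i} {j} Si yij with S j in eq
  ... | true  = _
  ... | false = ⊥-elim (¬Sj (closed Si (sameCycle-sym x (y⇒x ¬Sj (sameCycle-sym y yij)))))
    where ¬Sj : ¬ T (S j)
          ¬Sj t = subst T eq t

  leader-outside : ∀ {i} → ¬ T (S i) → CycleLeaders.isLeader x i ≡ CycleLeaders.isLeader y i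
  leader-outside {i} ¬Si =
    trans (isYes≗does (Lx.isLeader? i))
          (trans (does-⇔ (mk⇔ (λ l j j<i yij → l j j<i (y⇒x ¬Si yij)) (λ l j j<i xij → l j j<i (x⇒y ¬Si xij)))
                         (Lx.isLeader? i) (Ly.isLeader? i))
                 (sym (isYes≗does (Ly.isLeader? i))))
    where module Lx = CycleLeaders x
          module Ly = CycleLeaders y

  -- Outside S the cycles of x and y coincide, so only the cycles inside S differ.
  cycles-balance : cycles x + cyclesIn y S ≡ cycles y + cyclesIn x S
  cycles-balance =
    begin
      cycles x + cyclesIn y S                       ≡⟨ cong (_+ cyclesIn y S) (cycles-split x S) ⟩
      (cyclesIn x S + rest x) + cyclesIn y S        ≡⟨ cong (λ r → (cyclesIn x S + r) + cyclesIn y S) (count-cong same-rest) ⟩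
      (cyclesIn x S + rest y) + cyclesIn y S        ≡⟨ swap-ends (cyclesIn x S) (rest y) (cyclesIn y S) ⟩
      (cyclesIn y S + rest y) + cyclesIn x S        ≡⟨ cong (_+ cyclesIn x S) (sym (cycles-split y S)) ⟩
      cycles y + cyclesIn x S                       ∎
    where
    open ≡-Reasoning
    rest : Perm N → ℕ
    rest z = count (λ i → CycleLeaders.isLeader z i ∧ not (S i))
    same-rest : ∀ i → CycleLeaders.isLeader x i ∧ not (S i) ≡ CycleLeaders.isLeader y i ∧ not (S i)
    same-rest i = ∧-not-cong (S i) leader-outside

opaque
  unfolding cycles

  cycles-≈ : ∀ {N} {x y : Perm N} → x ≈ₚ y → cycles x ≡ cycles y
  cycles-≈ {x = x} {y} x≈y = count-cong (λ i → leader-outside x y (λ _ → false) (λ ()) (λ m _ → sym (x≈y m)) {i} (λ ()))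

cyclesOf : ∀ {N} → Perm N → List (Fin N) → Fin N → Bool
cyclesOf x ps m = any (λ p → ⌊ sameCycle? x p m ⌋) ps

module _ {N : ℕ} (x : Perm N) (ps : List (Fin N)) where

  cyclesOf⁻ : ∀ {m} → T (cyclesOf x ps m) → Any (λ p → SameCycle x p m) ps
  cyclesOf⁻ {m} t = Any.map toWitness (any⁻ (λ p → ⌊ sameCycle? x p m ⌋) ps t)

  cyclesOf⁺ : ∀ {m} → Any (λ p → SameCycle x p m) ps → T (cyclesOf x ps m)
  cyclesOf⁺ {m} pm = any⁺ (λ p → ⌊ sameCycle? x p m ⌋) (Any.map fromWitness pm)

  cyclesOf-closed : CycleLeaders.Closed x (cyclesOf x ps)
  cyclesOf-closed t ij = cyclesOf⁺ (Any.map (λ pi → sameCycle-trans x pi ij) (cyclesOf⁻ t))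

  ∈-cyclesOf : ∀ {p} → p ∈ ps → T (cyclesOf x ps p)
  ∈-cyclesOf p∈ps = cyclesOf⁺ (Any.map (λ { refl → sameCycle-refl x }) p∈ps)

module _ {N : ℕ} (x y : Perm N) (ps : List (Fin N)) (agree : ∀ m → m ∉ ps → y ⟨$⟩ʳ m ≡ x ⟨$⟩ʳ m) where

  private
    S : Fin N → Bool
    S = cyclesOf x ps

    agree-outside : ∀ m → ¬ T (S m) → y ⟨$⟩ʳ m ≡ x ⟨$⟩ʳ m
    agree-outside m ¬Sm = agree m (¬Sm ∘ ∈-cyclesOf x ps)

    balance : cycles x + cyclesIn y S ≡ cycles y + cyclesIn x S
    balance = cycles-balance x y S (cyclesOf-closed x ps) agree-outside

  cycles-≤-perturb : ∀ {p₀} → p₀ ∈ ps → ∀ q qs → (∀ {p} → p ∈ ps → Any (λ g → SameCycle x g p) (q ∷ qs)) →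
                     cycles x ≤ cycles y + length qs
  cycles-≤-perturb p₀∈ps q qs cover = s≤s⁻¹ (begin
      suc (cycles x)            ≡⟨ +-comm 1 (cycles x) ⟩
      cycles x + 1              ≤⟨ +-monoʳ-≤ (cycles x) y-has-one ⟩
      cycles x + cyclesIn y S   ≡⟨ balance ⟩
      cycles y + cyclesIn x S   ≤⟨ +-monoʳ-≤ (cycles y) x-has-few ⟩
      cycles y + suc (length qs) ≡⟨ +-suc (cycles y) (length qs) ⟩
      suc (cycles y + length qs) ∎)
    where
    open ≤-Reasoning
    y-has-one : 1 ≤ cyclesIn y S
    y-has-one = CycleLeaders.length≤leadersIn y S (closed-under-both x y S (cyclesOf-closed x ps) agree-outside)
                  ([] ∷ []) (∈-cyclesOf x ps p₀∈ps ∷ [])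
    x-has-few : cyclesIn x S ≤ suc (length qs)
    x-has-few = CycleLeaders.leadersIn≤length x S (q ∷ qs) (λ m Sm →
      let p , p∈ps , pm = find (cyclesOf⁻ x ps Sm) in Any.map (λ gp → sameCycle-trans x gp pm) (cover p∈ps))

  cycles-merge : AllPairs (λ a b → ¬ SameCycle x a b) ps → ∀ g →
                 (∀ {p m} → p ∈ ps → SameCycle x p m → SameCycle y g m) →
                 cycles y + length ps ≤ cycles x + 1
  cycles-merge apart g joined = begin
      cycles y + length ps      ≤⟨ +-monoʳ-≤ (cycles y) x-has-many ⟩
      cycles y + cyclesIn x S   ≡⟨ sym balance ⟩
      cycles x + cyclesIn y S   ≤⟨ +-monoʳ-≤ (cycles x) y-has-one ⟩
      cycles x + 1              ∎
    where
    open ≤-Reasoning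
    x-has-many : length ps ≤ cyclesIn x S
    x-has-many = CycleLeaders.length≤leadersIn x S (cyclesOf-closed x ps) apart (All.tabulate (∈-cyclesOf x ps))
    y-has-one : cyclesIn y S ≤ 1
    y-has-one = CycleLeaders.leadersIn≤length y S (g ∷ []) (λ m Sm →
      let p , p∈ps , pm = find (cyclesOf⁻ x ps Sm) in here (joined p∈ps pm))

-- y = c ∘ₚ x for the 3-cycle c = (u v w), recorded pointwise.
record Rotated {N} (x : Perm N) (u v w : Fin N) (y : Perm N) : Set where
  field
    at-u : y ⟨$⟩ʳ u ≡ x ⟨$⟩ʳ v
    at-v : y ⟨$⟩ʳ v ≡ x ⟨$⟩ʳ w
    at-w : y ⟨$⟩ʳ w ≡ x ⟨$⟩ʳ u
    elsewhere : ∀ m → m ≢ u → m ≢ v → m ≢ w → y ⟨$⟩ʳ m ≡ x ⟨$⟩ʳ m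

Apart : ∀ {N} → Perm N → Fin N → Fin N → Fin N → Set
Apart x u v w = ¬ SameCycle x u v × ¬ SameCycle x v w × ¬ SameCycle x u w

module _ {N : ℕ} {x y : Perm N} {u v w : Fin N} (rot : Rotated x u v w y) where

  open Rotated rot

  private
    agree-off : ∀ m → m ∉ u ∷ v ∷ w ∷ [] → y ⟨$⟩ʳ m ≡ x ⟨$⟩ʳ m
    agree-off m m∉ = elsewhere m (m∉ ∘ here) (m∉ ∘ there ∘ here) (m∉ ∘ there ∘ there ∘ here)

    perturb : ∀ q qs → (∀ {p} → p ∈ u ∷ v ∷ w ∷ [] → Any (λ g → SameCycle x g p) (q ∷ qs)) → cycles x ≤ cycles y + length qs
    perturb = cycles-≤-perturb x y (u ∷ v ∷ w ∷ []) agree-off (here refl)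

  cycles-≤-rotate : cycles x ≤ cycles y + 2
  cycles-≤-rotate = perturb u (v ∷ w ∷ []) (Any.map (λ { refl → sameCycle-refl x }))

  private
    2+n≰1+n : ∀ n → ¬ (n + 2 ≤ n + 1)
    2+n≰1+n n le = 2≰1 (+-cancelˡ-≤ n 2 1 le)
      where 2≰1 : ¬ (2 ≤ 1)
            2≰1 (s≤s ())

  rotate-tight⇒apart : cycles x ≡ cycles y + 2 → Apart x u v w
  rotate-tight⇒apart tight =
      (λ u~v → below (perturb u (w ∷ []) (cover-uv u~v)))
    , (λ v~w → below (perturb u (v ∷ []) (cover-vw v~w)))
    , (λ u~w → below (perturb u (v ∷ []) (cover-uw u~w)))
    where
    below : ¬ (cycles x ≤ cycles y + 1)
    below le = 2+n≰1+n (cycles y) (subst (_≤ cycles y + 1) tight le)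
    refl~ : ∀ {p} → SameCycle x p p
    refl~ = sameCycle-refl x
    cover-uv : SameCycle x u v → ∀ {p} → p ∈ u ∷ v ∷ w ∷ [] → Any (λ g → SameCycle x g p) (u ∷ w ∷ [])
    cover-uv u~v (here refl)                 = here refl~
    cover-uv u~v (there (here refl))         = here u~v
    cover-uv u~v (there (there (here refl))) = there (here refl~)
    cover-vw : SameCycle x v w → ∀ {p} → p ∈ u ∷ v ∷ w ∷ [] → Any (λ g → SameCycle x g p) (u ∷ v ∷ [])
    cover-vw v~w (here refl)                 = here refl~
    cover-vw v~w (there (here refl))         = there (here refl~)
    cover-vw v~w (there (there (here refl))) = there (here v~w)
    cover-uw : SameCycle x u w → ∀ {p} → p ∈ u ∷ v ∷ w ∷ [] → Any (λ g → SameCycle x g p) (u ∷ v ∷ [])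
    cover-uw u~w (here refl)                 = here refl~
    cover-uw u~w (there (here refl))         = there (here refl~)
    cover-uw u~w (there (there (here refl))) = here u~w

  module Joined (apart : Apart x u v w) {p q r : ℕ}
                (len-u : CycleLen x u p) (len-v : CycleLen x v q) (len-w : CycleLen x w r) where

    private
      u≁v : ¬ SameCycle x u v
      u≁v = proj₁ apart
      v≁w : ¬ SameCycle x v w
      v≁w = proj₁ (proj₂ apart)
      u≁w : ¬ SameCycle x u w
      u≁w = proj₂ (proj₂ apart)
      v≁u : ¬ SameCycle x v u
      v≁u = u≁v ∘ sameCycle-sym x
      w≁v : ¬ SameCycle x w v
      w≁v = v≁w ∘ sameCycle-sym x
      w≁u : ¬ SameCycle x w u
      w≁u = u≁w ∘ sameCycle-sym x

      first : ∀ {b L} → CycleLen x b L → ∀ n → 1 ≤ n → n < L → iter x n b ≢ b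
      first (_ , _ , first) = first

      via-v : ∀ n → 1 ≤ n → n ≤ q → iter y n u ≡ iter x n v
      via-v = iter-redirect x y at-u λ n n≥1 n<q →
        elsewhere _ (λ e → v≁u (n , e)) (first len-v n n≥1 n<q) (λ e → v≁w (n , e))

      via-w : ∀ n → 1 ≤ n → n ≤ r → iter y n v ≡ iter x n w
      via-w = iter-redirect x y at-v λ n n≥1 n<r →
        elsewhere _ (λ e → w≁u (n , e)) (λ e → w≁v (n , e)) (first len-w n n≥1 n<r)

      via-u : ∀ n → 1 ≤ n → n ≤ p → iter y n w ≡ iter x n u
      via-u = iter-redirect x y at-w λ n n≥1 n<p →
        elsewhere _ (first len-u n n≥1 n<p) (λ e → u≁v (n , e)) (λ e → u≁w (n , e))

      arrive : ∀ {a b L} → CycleLen x b L → (∀ n → 1 ≤ n → n ≤ L → iter y n a ≡ iter x n b) → iter y L a ≡ b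
      arrive (L≥1 , ret , _) via = trans (via _ L≥1 ≤-refl) ret

      u→v : iter y q u ≡ v
      u→v = arrive len-v via-v
      u→w : iter y (r + q) u ≡ w
      u→w = trans (iter-+ y r q u) (trans (cong (iter y r) u→v) (arrive len-w via-w))

      reach : ∀ {a b L′ m} t → iter y t u ≡ a → CycleLen x b L′ →
              (∀ n → 1 ≤ n → n ≤ L′ → iter y n a ≡ iter x n b) → SameCycle x b m → SameCycle y u m
      reach {a} {b} {L′} t t→a len via b~m with sameCycle-within x len b~m
      ... | zero  , _   , refl = L′ + t , trans (iter-+ y L′ t u) (trans (cong (iter y L′) t→a) (arrive len via))
      ... | suc n , n<L , refl = suc n + t , trans (iter-+ y (suc n) t u)
                                   (trans (cong (iter y (suc n)) t→a) (via (suc n) (s≤s z≤n) (<⇒≤ n<L)))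

    L : ℕ
    L = p + (r + q)

    -- From u, the y-orbit runs along the x-cycle of v (q steps), then of w (r steps), then of u (p steps).
    cycleLen-joined : CycleLen y u L
    cycleLen-joined = ≤-trans (proj₁ len-u) (m≤m+n p (r + q)) ,
                      trans (iter-+ y p (r + q) u) (trans (cong (iter y p) u→w) (arrive len-u via-u)) ,
                      no-early-return
      where
      no-early-return : ∀ m → 1 ≤ m → m < L → iter y m u ≢ u
      no-early-return m m≥1 m<L ret with m ≤? q
      ... | yes m≤q = v≁u (m , trans (sym (via-v m m≥1 m≤q)) ret)
      ... | no m≰q with ≰⇒∃+ m≰q
      ...   | n , n≥1 , refl with n ≤? r
      ...     | yes n≤r = w≁u (n , trans (sym (via-w n n≥1 n≤r))
                                   (trans (cong (iter y n) (sym u→v)) (trans (sym (iter-+ y n q u)) ret)))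
      ...     | no n≰r with ≰⇒∃+ n≰r
      ...       | k , k≥1 , refl = first len-u k k≥1 k<p
          (trans (sym (via-u k k≥1 (<⇒≤ k<p)))
          (trans (cong (iter y k) (sym u→w))
          (trans (sym (iter-+ y k (r + q) u))
          (trans (cong (λ t → iter y t u) (sym (+-assoc k r q))) ret))))
        where
        k<p : k < p
        k<p = +-cancelʳ-< (r + q) k p (subst (_< L) (+-assoc k r q) m<L)

    joined : ∀ {g m} → g ∈ u ∷ v ∷ w ∷ [] → SameCycle x g m → SameCycle y u m
    joined (here refl)                 = reach (r + q) u→w len-u via-u
    joined (there (here refl))         = reach 0 refl len-v via-v
    joined (there (there (here refl))) = reach q u→v len-w via-w

    cycles-join : cycles x ≡ cycles y + 2
    cycles-join = ≤-antisym (cycles-≤-rotate) (+-cancelʳ-≤ 1 (cycles y + 2) (cycles x)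
      (subst (_≤ cycles x + 1) (sym (+-assoc (cycles y) 2 1))
        (cycles-merge x y (u ∷ v ∷ w ∷ []) agree-off ((u≁v ∷ u≁w ∷ []) ∷ (v≁w ∷ []) ∷ [] ∷ []) u joined)))

    private
      unaffected : ∀ {m} → ¬ SameCycle x m u → ¬ SameCycle x m v → ¬ SameCycle x m w → ∀ k → iter x k m ≡ iter y k m
      unaffected m≁u m≁v m≁w = orbit-agree λ k →
        sym (elsewhere _ (λ e → m≁u (k , e)) (λ e → m≁v (k , e)) (λ e → m≁w (k , e)))

      apart-from-joined : ∀ {m} → ¬ SameCycle y u m → ∀ {g} → g ∈ u ∷ v ∷ w ∷ [] → ¬ SameCycle x m g
      apart-from-joined u≁m g∈ m~g = u≁m (joined g∈ (sameCycle-sym x m~g))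

    allCyclesOdd-join : AllCyclesOdd x → AllCyclesOdd y
    allCyclesOdd-join odd m Lm len = by-cases (sameCycle? y u m)
      where
      by-cases : Dec (SameCycle y u m) → Odd Lm
      by-cases (yes u~m) = subst Odd (cycleLen-unique y (cycleLen-sameCycle y u~m cycleLen-joined) len)
                             (odd+odd+odd (odd u p len-u) (odd w r len-w) (odd v q len-v))
      by-cases (no u≁m)  = odd m Lm (cycleLen-orbit (λ k → sym (unaffected (m≁ (here refl)) (m≁ (there (here refl)))
                                                                          (m≁ (there (there (here refl)))) k)) len)
        where
        m≁ : ∀ {g} → g ∈ u ∷ v ∷ w ∷ [] → ¬ SameCycle x m g
        m≁ = apart-from-joined u≁m

    allCyclesOdd-split : AllCyclesOdd y → Odd q → Odd r → AllCyclesOdd x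
    allCyclesOdd-split odd odd-q odd-r m Lm len = by-cases (sameCycle? x u m) (sameCycle? x v m) (sameCycle? x w m)
      where
      length-is : ∀ {g Lg} → SameCycle x g m → CycleLen x g Lg → Lg ≡ Lm
      length-is g~m len-g = cycleLen-unique x (cycleLen-sameCycle x g~m len-g) len
      by-cases : Dec (SameCycle x u m) → Dec (SameCycle x v m) → Dec (SameCycle x w m) → Odd Lm
      by-cases (yes u~m) _         _         =
        subst Odd (length-is u~m len-u) (odd+odd+odd-cancelʳ (odd u L cycleLen-joined) odd-r odd-q)
      by-cases (no _)    (yes v~m) _         = subst Odd (length-is v~m len-v) odd-q
      by-cases (no _)    (no _)    (yes w~m) = subst Odd (length-is w~m len-w) odd-r
      by-cases (no u≁m)  (no v≁m)  (no w≁m)  =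
        odd m Lm (cycleLen-orbit (unaffected (u≁m ∘ sameCycle-sym x) (v≁m ∘ sameCycle-sym x) (w≁m ∘ sameCycle-sym x)) len)

-- Lower bounds on ℓ₂ and ℓ₃

module _ {N : ℕ} where

  cycles-≤-transposition : ∀ (x : Perm N) {t} → IsTransposition t → cycles x ≤ cycles (t ∘ₚ x) + 1
  cycles-≤-transposition x {t} (i , j , _ , t≈) =
    cycles-≤-perturb x (t ∘ₚ x) (i ∷ j ∷ []) agree-off (here refl) i (j ∷ [])
      (Any.map (λ { refl → sameCycle-refl x }))
    where
    agree-off : ∀ m → m ∉ i ∷ j ∷ [] → (t ∘ₚ x) ⟨$⟩ʳ m ≡ x ⟨$⟩ʳ m
    agree-off m m∉ = cong (x ⟨$⟩ʳ_) (trans (t≈ m) (transpose-other i j m (m∉ ∘ here) (m∉ ∘ there ∘ here)))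

  rotated-threeCycle : ∀ {x y : Perm N} {c} → ((u , v , w , _) : IsThreeCycle c) → (c ∘ₚ x) ≈ₚ y → Rotated x u v w y
  rotated-threeCycle {x} (u , v , w , _ , _ , _ , cu , cv , cw , c-other) c∘x≈y = record
    { at-u = trans (sym (c∘x≈y u)) (cong (x ⟨$⟩ʳ_) cu)
    ; at-v = trans (sym (c∘x≈y v)) (cong (x ⟨$⟩ʳ_) cv)
    ; at-w = trans (sym (c∘x≈y w)) (cong (x ⟨$⟩ʳ_) cw)
    ; elsewhere = λ m m≢u m≢v m≢w → trans (sym (c∘x≈y m)) (cong (x ⟨$⟩ʳ_) (c-other m m≢u m≢v m≢w))
    }

  cycles-≤-threeCycle : ∀ (x : Perm N) {c} → IsThreeCycle c → cycles x ≤ cycles (c ∘ₚ x) + 2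
  cycles-≤-threeCycle x {c} c-cycle = cycles-≤-rotate (rotated-threeCycle {x} {c ∘ₚ x} {c} c-cycle (λ _ → refl))

  cycles-id : cycles (id {N}) ≡ N
  cycles-id = cycles-fixed id (λ _ → refl)

  size≤cycles+length : ∀ {k} {P : Perm N → Set} → (∀ x {g} → P g → cycles x ≤ cycles (g ∘ₚ x) + k) →
                       ∀ {gs} → All P gs → N ≤ cycles (prod gs) + k * length gs
  size≤cycles+length {k} step [] =
    ≤-reflexive (sym (trans (cong (cycles (id {N}) +_) (*-zeroʳ k)) (trans (+-identityʳ (cycles (id {N}))) cycles-id)))
  size≤cycles+length {k} {P} step {g ∷ gs} (Pg ∷ Pgs) =
    accumulate {a = cycles (prod gs)} {cycles (prod (g ∷ gs))} {k} {length gs}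
      (size≤cycles+length {k} {P} step Pgs) (step (prod gs) {g} Pg)
    where
    accumulate : ∀ {n a b k m} → n ≤ a + k * m → a ≤ b + k → n ≤ b + k * suc m
    accumulate {n} {a} {b} {k} {m} n≤ a≤ = begin
      n                 ≤⟨ n≤ ⟩
      a + k * m         ≤⟨ +-monoˡ-≤ (k * m) a≤ ⟩
      (b + k) + k * m   ≡⟨ +-assoc b k (k * m) ⟩
      b + (k + k * m)   ≡⟨ cong (b +_) (sym (*-suc k m)) ⟩
      b + k * suc m     ∎
      where open ≤-Reasoning

  size≤cycles+ℓ₂ : ∀ {x : Perm N} {n} → ProdTransp x n → N ≤ cycles x + n
  size≤cycles+ℓ₂ (ts , transpositions , refl , prod≈x) =
    subst₂ (λ c l → N ≤ c + l) (cycles-≈ prod≈x) (*-identityˡ (length ts))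
      (size≤cycles+length cycles-≤-transposition transpositions)

  size≤cycles+2ℓ₃ : ∀ {x : Perm N} {n} → Prod3 x n → N ≤ cycles x + 2 * n
  size≤cycles+2ℓ₃ (cs , threeCycles , refl , prod≈x) =
    subst (λ c → N ≤ c + 2 * length cs) (cycles-≈ prod≈x) (size≤cycles+length cycles-≤-threeCycle threeCycles)

  prod3⇒prodTransp : ∀ {x : Perm N} {n} → Prod3 x n → ProdTransp x (2 * n)
  prod3⇒prodTransp (cs , threeCycles , refl , prod≈x) =
    let ts , transpositions , length≡ , prod≈ = split threeCycles in
    ts , transpositions , length≡ , λ m → trans (prod≈ m) (prod≈x m)
    where
    split : ∀ {cs} → All IsThreeCycle cs →
            Σ (List (Perm N)) λ ts → All IsTransposition ts × length ts ≡ 2 * length cs × prod ts ≈ₚ prod cs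
    split [] = [] , [] , refl , λ _ → refl
    split {c ∷ cs} (c-cycle@(u , v , w , u≢v , _ , u≢w , _) ∷ threeCycles) =
      let ts , transpositions , length≡ , prod≈ = split threeCycles in
      transpose u v ∷ transpose u w ∷ ts ,
      (u , v , u≢v , λ _ → refl) ∷ (u , w , u≢w , λ _ → refl) ∷ transpositions ,
      trans (cong (2 +_) length≡) (sym (*-suc 2 (length cs))) ,
      λ m → trans (prod≈ _) (cong (prod cs ⟨$⟩ʳ_) (sym (isThreeCycle-≈ {c = c} c-cycle m)))

-- Permutations with odd cycles

⟨$⟩ʳ⇒⟨$⟩ˡ : ∀ {N} (s : Perm N) {a b} → s ⟨$⟩ʳ a ≡ b → s ⟨$⟩ˡ b ≡ a
⟨$⟩ʳ⇒⟨$⟩ˡ s refl = inverseˡ s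

module _ {N : ℕ} where

  no-2-cycle : ∀ {x : Perm N} {i} → AllCyclesOdd x → x ⟨$⟩ʳ i ≢ i → iter x 2 i ≢ i
  no-2-cycle {x} {i} odd moved ret =
    let m , 2≡1+2m = odd i 2 (s≤s z≤n , ret , λ { 1 _ _ → moved ; (suc (suc _)) _ (s≤s (s≤s ())) }) in
    even≢odd 1 m 2≡1+2m

  -- x is the join at i, x i, x² i of the permutation x′ in which x i and x² i are fixed.
  peel : ∀ (x : Perm N) → AllCyclesOdd x → ∀ {i} → x ⟨$⟩ʳ i ≢ i →
         ∃[ x′ ] (AllCyclesOdd x′ × cycles x′ ≡ cycles x + 2 × ∃[ c ] (IsThreeCycle c × (c ∘ₚ x′) ≈ₚ x))
  peel x odd {i} moved = x′ , J.allCyclesOdd-split odd (0 , refl) (0 , refl) , J.cycles-join ,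
                         c , isThreeCycle-threeCycle i≢j j≢k i≢k , λ m → cong (x ⟨$⟩ʳ_) (inverseˡ c)
    where
    j k : Fin N
    j = x ⟨$⟩ʳ i
    k = x ⟨$⟩ʳ j
    i≢j : i ≢ j
    i≢j = moved ∘ sym
    j≢k : j ≢ k
    j≢k = moved ∘ sym ∘ ⟨$⟩ʳ-injective x
    i≢k : i ≢ k
    i≢k = no-2-cycle odd moved ∘ sym
    c x′ : Perm N
    c = threeCycle i j k
    x′ = flip c ∘ₚ x
    unrotate : ∀ {a b} → c ⟨$⟩ʳ a ≡ b → x ⟨$⟩ʳ a ≡ x′ ⟨$⟩ʳ b
    unrotate ca≡b = cong (x ⟨$⟩ʳ_) (sym (⟨$⟩ʳ⇒⟨$⟩ˡ c ca≡b))
    rotated : Rotated x′ i j k x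
    rotated = record
      { at-u = unrotate (threeCycle-u i≢j j≢k i≢k)
      ; at-v = unrotate (threeCycle-v i≢j j≢k i≢k)
      ; at-w = unrotate (threeCycle-w i≢j j≢k i≢k)
      ; elsewhere = λ m m≢i m≢j m≢k → unrotate (threeCycle-other i≢j j≢k i≢k m m≢i m≢j m≢k)
      }
    j-fixed : x′ ⟨$⟩ʳ j ≡ j
    j-fixed = sym (Rotated.at-u rotated)
    k-fixed : x′ ⟨$⟩ʳ k ≡ k
    k-fixed = sym (Rotated.at-v rotated)
    apart : Apart x′ i j k
    apart = (λ i~j → i≢j (fixed-sameCycle x′ j-fixed (sameCycle-sym x′ i~j))) ,
            (λ j~k → j≢k (sym (fixed-sameCycle x′ j-fixed j~k))) ,
            (λ i~k → i≢k (fixed-sameCycle x′ k-fixed (sameCycle-sym x′ i~k)))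
    module J = Joined rotated apart (proj₂ (cycleLength x′ i)) (fixed-cycleLen x′ j-fixed)
                                    (fixed-cycleLen x′ k-fixed)

  decompose : ∀ d (x : Perm N) → AllCyclesOdd x → N ≡ cycles x + d → ∃[ a ] (d ≡ 2 * a × Prod3 x a)
  decompose d x odd size≡ = by-cases (any? (λ i → ¬? (x ⟨$⟩ʳ i ≟ i)))
    where
    by-cases : Dec (∃[ i ] x ⟨$⟩ʳ i ≢ i) → ∃[ a ] (d ≡ 2 * a × Prod3 x a)
    by-cases (no none) = 0 , +-cancelˡ-≡ (cycles x) d 0 (trans (sym size≡′) (sym (+-identityʳ (cycles x)))) ,
                         [] , [] , refl , λ m → sym (fixed m)
      where
      fixed : ∀ m → x ⟨$⟩ʳ m ≡ m
      fixed m = decidable-stable (x ⟨$⟩ʳ m ≟ m) (λ moved → none (m , moved))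
      size≡′ : cycles x ≡ cycles x + d
      size≡′ = trans (cycles-fixed x fixed) size≡
    by-cases (yes (i , moved)) = extend (peel x odd moved)
      where
      extend : ∃[ x′ ] (AllCyclesOdd x′ × cycles x′ ≡ cycles x + 2 × ∃[ c ] (IsThreeCycle c × (c ∘ₚ x′) ≈ₚ x)) →
               ∃[ a ] (d ≡ 2 * a × Prod3 x a)
      extend (x′ , odd′ , cycles≡ , c , c-cycle , c∘x′≈x) = shrink d 2≤d size≡
        where
        2≤d : 2 ≤ d
        2≤d = +-cancelˡ-≤ (cycles x) 2 d
                (≤-trans (≤-reflexive (sym cycles≡)) (≤-trans (cycles≤size x′) (≤-reflexive size≡)))
        shrink : ∀ e → 2 ≤ e → N ≡ cycles x + e → ∃[ a ] (e ≡ 2 * a × Prod3 x a)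
        shrink 1             (s≤s ())
        shrink (suc (suc e)) _ size≡ =
          let a , e≡2a , cs , threeCycles , length≡ , prod≈ = decompose e x′ odd′ size≡′ in
          suc a , trans (cong (2 +_) e≡2a) (sym (*-suc 2 a)) ,
          c ∷ cs , c-cycle ∷ threeCycles , cong suc length≡ , λ m → trans (prod≈ (c ⟨$⟩ʳ m)) (c∘x′≈x m)
          where
          size≡′ : N ≡ cycles x′ + e
          size≡′ = trans size≡ (trans (sym (+-assoc (cycles x) 2 e)) (cong (_+ e) (sym cycles≡)))

  ℓ-allCyclesOdd : ∀ (x : Perm N) → AllCyclesOdd x → ∃[ a ] (IsL3 x a × IsL2 x (2 * a) × N ≡ cycles x + 2 * a)
  ℓ-allCyclesOdd x odd =
    let a , excess≡2a , product = decompose (N ∸ cycles x) x odd (sym (m+[n∸m]≡n (cycles≤size x)))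
        size≡ = trans (sym (m+[n∸m]≡n (cycles≤size x))) (cong (cycles x +_) excess≡2a)
    in a ,
       (product , λ m p → *-cancelˡ-≤ 2 (+-cancelˡ-≤ (cycles x) _ _ (subst (_≤ cycles x + 2 * m) size≡ (size≤cycles+2ℓ₃ p)))) ,
       (prod3⇒prodTransp {x = x} product , λ m p → +-cancelˡ-≤ (cycles x) _ _ (subst (_≤ cycles x + m) size≡ (size≤cycles+ℓ₂ p))) ,
       size≡

-- The order ≤₃

module _ {N : ℕ} where

  ∘ₚ-cong : ∀ {a a′ b b′ : Perm N} → a ≈ₚ a′ → b ≈ₚ b′ → (a ∘ₚ b) ≈ₚ (a′ ∘ₚ b′)
  ∘ₚ-cong {b = b} a≈a′ b≈b′ m = trans (cong (b ⟨$⟩ʳ_) (a≈a′ m)) (b≈b′ _)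

  quotient-∘ₚ : ∀ (x y : Perm N) → ((y ∘ₚ flip x) ∘ₚ x) ≈ₚ y
  quotient-∘ₚ x y m = inverseʳ x

  quotient-id : ∀ {x y : Perm N} → id ≈ₚ (y ∘ₚ flip x) → x ≈ₚ y
  quotient-id {x} {y} id≈ m = trans (cong (x ⟨$⟩ʳ_) (id≈ m)) (inverseʳ x)

  prod-++ : ∀ (ds cs : List (Perm N)) → prod (ds ++ cs) ≈ₚ (prod ds ∘ₚ prod cs)
  prod-++ []       cs m = refl
  prod-++ (d ∷ ds) cs m = prod-++ ds cs (d ⟨$⟩ʳ m)

  prod3-≈ : ∀ {x y : Perm N} {n} → x ≈ₚ y → Prod3 x n → Prod3 y n
  prod3-≈ x≈y (cs , threeCycles , length≡ , prod≈) = cs , threeCycles , length≡ , λ m → trans (prod≈ m) (x≈y m)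

  prod3-∘ₚ : ∀ {g h : Perm N} {m n} → Prod3 g m → Prod3 h n → Prod3 (g ∘ₚ h) (m + n)
  prod3-∘ₚ {g} {h} (ds , ds3 , refl , prod≈g) (cs , cs3 , refl , prod≈h) =
    ds ++ cs , Allₚ.++⁺ ds3 cs3 , length-++ ds ,
    λ m → trans (prod-++ ds cs m) (∘ₚ-cong {prod ds} {g} {prod cs} {h} prod≈g prod≈h m)

  prod3-single : ∀ {c : Perm N} → IsThreeCycle c → Prod3 c 1
  prod3-single {c} c-cycle = c ∷ [] , c-cycle ∷ [] , refl , λ _ → refl

  prod3-zero : ∀ {x : Perm N} → Prod3 x 0 → id ≈ₚ x
  prod3-zero ([] , _ , _ , id≈x) = id≈x

  ℓ₃-unique : ∀ {x : Perm N} {m n} → IsL3 x m → IsL3 x n → m ≡ n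
  ℓ₃-unique (p , min) (p′ , min′) = ≤-antisym (min _ p′) (min′ _ p)

  prod3-quotient-pos : ∀ {x y : Perm N} {n} → Prod3 (y ∘ₚ flip x) n → ¬ x ≈ₚ y → 1 ≤ n
  prod3-quotient-pos {x} {y} {zero} p x≉y = ⊥-elim (x≉y (quotient-id {x} {y} (prod3-zero {y ∘ₚ flip x} p)))
  prod3-quotient-pos {n = suc n}    _ _   = s≤s z≤n

  allCyclesOdd-id : AllCyclesOdd (id {N})
  allCyclesOdd-id i L len = subst Odd (cycleLen-unique id (fixed-cycleLen id refl) len) (0 , refl)

  allCyclesOdd-≈ : ∀ {x y : Perm N} → x ≈ₚ y → AllCyclesOdd x → AllCyclesOdd y
  allCyclesOdd-≈ x≈y odd i L len = odd i L (cycleLen-orbit (λ k → sym (iter-≈ x≈y k)) len)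

  Tight : List (Perm N) → Set
  Tight cs = N ≡ cycles (prod cs) + 2 * length cs

  tight-tail : ∀ {c cs} → IsThreeCycle c → All IsThreeCycle cs → Tight (c ∷ cs) →
               Tight cs × cycles (prod cs) ≡ cycles (c ∘ₚ prod cs) + 2
  tight-tail {c} {cs} c-cycle threeCycles tight = trans tight (trans regroup (cong (_+ 2 * n) (sym X≡Y+2))) , X≡Y+2
    where
    X Y n : ℕ
    X = cycles (prod cs)
    Y = cycles (c ∘ₚ prod cs)
    n = length cs
    regroup : Y + 2 * suc n ≡ (Y + 2) + 2 * n
    regroup = trans (cong (Y +_) (*-suc 2 n)) (sym (+-assoc Y 2 (2 * n)))
    X≡Y+2 : X ≡ Y + 2
    X≡Y+2 = ≤-antisym (cycles-≤-threeCycle (prod cs) {c} c-cycle)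
      (+-cancelʳ-≤ (2 * n) (Y + 2) X (≤-trans (≤-reflexive (sym (trans tight regroup)))
                                                (size≤cycles+length cycles-≤-threeCycle threeCycles)))

  tight⇒allCyclesOdd : ∀ {cs} → All IsThreeCycle cs → Tight cs → AllCyclesOdd (prod cs)
  tight⇒allCyclesOdd []                          _     = allCyclesOdd-id
  tight⇒allCyclesOdd {c ∷ cs} (c-cycle@(u , v , w , _) ∷ threeCycles) tight =
    Joined.allCyclesOdd-join rotated (rotate-tight⇒apart rotated X≡Y+2)
      (proj₂ (cycleLength x _)) (proj₂ (cycleLength x _)) (proj₂ (cycleLength x _))
      (tight⇒allCyclesOdd threeCycles tight′)
    where
    x : Perm N
    x = prod cs
    rotated : Rotated x u v w (c ∘ₚ x)
    rotated = rotated-threeCycle {x = x} {c ∘ₚ x} {c} c-cycle (λ _ → refl)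
    tight′ : Tight cs
    tight′ = proj₁ (tight-tail {c} c-cycle threeCycles tight)
    X≡Y+2 : cycles x ≡ cycles (c ∘ₚ x) + 2
    X≡Y+2 = proj₂ (tight-tail {c} c-cycle threeCycles tight)

  tight-suffix : ∀ ds {cs} → All IsThreeCycle (ds ++ cs) → Tight (ds ++ cs) → Tight cs
  tight-suffix []       _                       tight = tight
  tight-suffix (d ∷ ds) (d-cycle ∷ threeCycles) tight =
    tight-suffix ds threeCycles (proj₁ (tight-tail {d} d-cycle threeCycles tight))

  allCyclesOdd-below : ∀ {x y : Perm N} → AllCyclesOdd y → x ≤₃ y → AllCyclesOdd x
  allCyclesOdd-below {x} {y} odd-y
    (a , b , c , ℓ₃y , ((cs , cs3 , refl , cs≈x) , _) , ((ds , ds3 , refl , ds≈q) , _) , a≡b+c) =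
    allCyclesOdd-≈ cs≈x (tight⇒allCyclesOdd cs3 (tight-suffix ds (Allₚ.++⁺ ds3 cs3) tight))
    where
    a′ : ℕ
    a′ = proj₁ (ℓ-allCyclesOdd y odd-y)
    ds++cs≈y : prod (ds ++ cs) ≈ₚ y
    ds++cs≈y m = trans (prod-++ ds cs m)
                       (trans (∘ₚ-cong {prod ds} {y ∘ₚ flip x} {prod cs} {x} ds≈q cs≈x m) (quotient-∘ₚ x y m))
    a′≡length : a′ ≡ length (ds ++ cs)
    a′≡length = trans (ℓ₃-unique {y} (proj₁ (proj₂ (ℓ-allCyclesOdd y odd-y))) ℓ₃y)
                      (trans a≡b+c (trans (+-comm (length cs) (length ds)) (sym (length-++ ds))))
    tight : Tight (ds ++ cs)
    tight = trans (proj₂ (proj₂ (proj₂ (ℓ-allCyclesOdd y odd-y))))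
                  (cong₂ (λ k l → k + 2 * l) (sym (cycles-≈ ds++cs≈y)) a′≡length)

  quotient-≈ : ∀ {x y : Perm N} → x ≈ₚ y → id ≈ₚ (y ∘ₚ flip x)
  quotient-≈ {x} x≈y m = sym (trans (cong (flip x ⟨$⟩ʳ_) (sym (x≈y m))) (inverseˡ x))

  ℓ₃-quotient-pos⇒≉ : ∀ {x y : Perm N} {n} → IsL3 (y ∘ₚ flip x) (suc n) → ¬ x ≈ₚ y
  ℓ₃-quotient-pos⇒≉ {x} {y} (_ , min) x≈y with min 0 ([] , [] , refl , quotient-≈ {x} {y} x≈y)
  ... | ()

  prod3⇒inA : ∀ {x : Perm N} {n} → Prod3 x n → InA x
  prod3⇒inA {x} {n} p = 2 * n , prod3⇒prodTransp {x = x} p , n , refl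

  <₃⇒ℓ₃< : ∀ {x y : Perm N} → x <₃ y → ∀ {m n} → IsL3 x m → IsL3 y n → m < n
  <₃⇒ℓ₃< {x} {y} ((a , b , c , ℓy , ℓx , ℓq , a≡b+c) , x≉y) ℓx′ ℓy′ =
    subst₂ (λ m n → m < n) (ℓ₃-unique {x} ℓx ℓx′) (ℓ₃-unique {y} ℓy ℓy′)
      (subst (suc b ≤_) (sym a≡b+c)
        (subst (_≤ b + c) (+-comm b 1) (+-monoʳ-≤ b (prod3-quotient-pos {x} {y} (proj₁ ℓq) x≉y))))

  ℓ₃-quotient-one : ∀ {x y c : Perm N} → IsThreeCycle c → (c ∘ₚ x) ≈ₚ y → ¬ x ≈ₚ y → IsL3 (y ∘ₚ flip x) 1
  ℓ₃-quotient-one {x} {y} {c} c-cycle c∘x≈y x≉y =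
    (c ∷ [] , c-cycle ∷ [] , refl , λ m → trans (sym (inverseˡ x)) (cong (flip x ⟨$⟩ʳ_) (c∘x≈y m))) ,
    λ m p → prod3-quotient-pos {x} {y} p x≉y

module _ {N : ℕ} (x : Perm N) where

  sameCycle-image : ∀ {a b} → SameCycle x a b → SameCycle x (x ⟨$⟩ʳ a) (x ⟨$⟩ʳ b)
  sameCycle-image {a} {b} a~b =
    sameCycle-trans x (sameCycle-sym x (sameCycle-step x a)) (sameCycle-trans x a~b (sameCycle-step x b))

  sameCycle-preimage : ∀ {a b} → SameCycle x (x ⟨$⟩ʳ a) (x ⟨$⟩ʳ b) → SameCycle x a b
  sameCycle-preimage {a} {b} xa~xb =
    sameCycle-trans x (sameCycle-step x a) (sameCycle-trans x xa~xb (sameCycle-sym x (sameCycle-step x b)))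

  module _ {y : Perm N} where

    rotated⇒joinOf3 : ∀ {u v w} → Rotated x u v w y → Apart x u v w → JoinOf3 x (x ⟨$⟩ʳ u) (x ⟨$⟩ʳ v) (x ⟨$⟩ʳ w) y
    rotated⇒joinOf3 {u} {v} {w} rot (u≁v , v≁w , u≁w) =
      u≁v ∘ sameCycle-preimage , v≁w ∘ sameCycle-preimage , u≁w ∘ sameCycle-preimage ,
      trans (cong (y ⟨$⟩ʳ_) (inverseˡ x)) at-u ,
      trans (cong (y ⟨$⟩ʳ_) (inverseˡ x)) at-v ,
      trans (cong (y ⟨$⟩ʳ_) (inverseˡ x)) at-w ,
      λ m m≢u m≢v m≢w → elsewhere m (m≢u ∘ back) (m≢v ∘ back) (m≢w ∘ back)
      where
      open Rotated rot
      back : ∀ {m a} → m ≡ a → m ≡ flip x ⟨$⟩ʳ (x ⟨$⟩ʳ a)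
      back refl = sym (inverseˡ x)

    joinOf3⇒rotated : ∀ {a b c} → JoinOf3 x a b c y →
      let u = flip x ⟨$⟩ʳ a ; v = flip x ⟨$⟩ʳ b ; w = flip x ⟨$⟩ʳ c in Rotated x u v w y × Apart x u v w
    joinOf3⇒rotated {a} {b} {c} (a≁b , b≁c , a≁c , ya , yb , yc , elsewhere) =
      record { at-u = trans ya (sym (inverseʳ x))
             ; at-v = trans yb (sym (inverseʳ x))
             ; at-w = trans yc (sym (inverseʳ x))
             ; elsewhere = elsewhere } ,
      a≁b ∘ lift , b≁c ∘ lift , a≁c ∘ lift
      where
      lift : ∀ {g h} → SameCycle x (flip x ⟨$⟩ʳ g) (flip x ⟨$⟩ʳ h) → SameCycle x g h
      lift = subst₂ (SameCycle x) (inverseʳ x) (inverseʳ x) ∘ sameCycle-image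

module _ {N : ℕ} {x y : Perm N} {u v w : Fin N} (rot : Rotated x u v w y)
         (u≢v : u ≢ v) (v≢w : v ≢ w) (u≢w : u ≢ w) where

  open Rotated rot

  rotated⇒≈ : (threeCycle u v w ∘ₚ x) ≈ₚ y
  rotated⇒≈ m = by-position (≡-or-≢₃ m u v w)
    where
    by-position : m ≡ u ⊎ m ≡ v ⊎ m ≡ w ⊎ (m ≢ u × m ≢ v × m ≢ w) → (threeCycle u v w ∘ₚ x) ⟨$⟩ʳ m ≡ y ⟨$⟩ʳ m
    by-position (inj₁ refl)               = trans (cong (x ⟨$⟩ʳ_) (threeCycle-u u≢v v≢w u≢w)) (sym at-u)
    by-position (inj₂ (inj₁ refl))        = trans (cong (x ⟨$⟩ʳ_) (threeCycle-v u≢v v≢w u≢w)) (sym at-v)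
    by-position (inj₂ (inj₂ (inj₁ refl))) = trans (cong (x ⟨$⟩ʳ_) (threeCycle-w u≢v v≢w u≢w)) (sym at-w)
    by-position (inj₂ (inj₂ (inj₂ (m≢u , m≢v , m≢w)))) =
      trans (cong (x ⟨$⟩ʳ_) (threeCycle-other u≢v v≢w u≢w m m≢u m≢v m≢w)) (sym (elsewhere m m≢u m≢v m≢w))

module _ {N : ℕ} {x y : Perm N} {a b : ℕ} (ℓy : IsL3 y a) (ℓx : IsL3 x b) where

  interpolate : ∀ {d e es} → IsThreeCycle d → All IsThreeCycle (e ∷ es) → prod (d ∷ e ∷ es) ≈ₚ (y ∘ₚ flip x) →
                (∀ m → Prod3 (y ∘ₚ flip x) m → length (d ∷ e ∷ es) ≤ m) → a ≡ b + length (d ∷ e ∷ es) →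
                ∃[ z ] (InA z × x <₃ z × z <₃ y)
  interpolate {d} {e} {es} d-cycle threeCycles prod≈q min-q a≡ =
    z , prod3⇒inA {x = z} product-z ,
    ((k + b , b , k , ℓz , ℓx , ℓq′ , +-comm k b) , ℓ₃-quotient-pos⇒≉ {x = x} {z} ℓq′) ,
    ((a , k + b , 1 , ℓy , ℓz , ℓr , a≡k+b+1) , z≉y)
    where
    k : ℕ
    k = length (e ∷ es)
    z : Perm N
    z = prod (e ∷ es) ∘ₚ x
    a≡k+b+1 : a ≡ (k + b) + 1
    a≡k+b+1 = trans a≡ (trans (+-suc b k) (trans (cong suc (+-comm b k)) (+-comm 1 (k + b))))
    d∘z≈y : (d ∘ₚ z) ≈ₚ y
    d∘z≈y m = trans (cong (x ⟨$⟩ʳ_) (prod≈q m)) (inverseʳ x)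
    product-z : Prod3 z (k + b)
    product-z = prod3-∘ₚ {g = prod (e ∷ es)} {x} (e ∷ es , threeCycles , refl , λ _ → refl) (proj₁ ℓx)
    ℓz : IsL3 z (k + b)
    ℓz = product-z , λ m p → ≤-pred (subst (_≤ suc m) (trans a≡k+b+1 (+-comm (k + b) 1))
              (proj₂ ℓy (suc m) (prod3-≈ {x = d ∘ₚ z} {y} d∘z≈y (prod3-∘ₚ {g = d} {z} (prod3-single {c = d} d-cycle) p))))
    ℓq′ : IsL3 (z ∘ₚ flip x) k
    ℓq′ = (e ∷ es , threeCycles , refl , λ m → sym (inverseˡ x)) ,
          λ m p → ≤-pred (min-q (suc m)
            (prod3-≈ {x = d ∘ₚ (z ∘ₚ flip x)} {y ∘ₚ flip x} (λ i → trans (inverseˡ x) (prod≈q i))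
                     (prod3-∘ₚ {g = d} {z ∘ₚ flip x} (prod3-single {c = d} d-cycle) p)))
    z≉y : ¬ z ≈ₚ y
    z≉y z≈y = 1+n≰n (subst (_≤ k + b) (trans a≡k+b+1 (+-comm (k + b) 1))
                            (proj₂ ℓy (k + b) (prod3-≈ {x = z} {y} z≈y product-z)))
    ℓr : IsL3 (y ∘ₚ flip z) 1
    ℓr = ℓ₃-quotient-one {x = z} {y} {d} d-cycle d∘z≈y z≉y

module _ {X Y a b : ℕ} (balanced : X + 2 * b ≡ Y + 2 * a) where

  private
    shift : ∀ Y b → Y + 2 * (b + 1) ≡ (Y + 2) + 2 * b
    shift = solve 2 (λ Y b → Y :+ con 2 :* (b :+ con 1) := (Y :+ con 2) :+ con 2 :* b) refl

  step⇒cycles-gap : a ≡ b + 1 → X ≡ Y + 2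
  step⇒cycles-gap refl = +-cancelʳ-≡ (2 * b) X (Y + 2) (trans balanced (shift Y b))

  cycles-gap⇒step : X ≡ Y + 2 → a ≡ b + 1
  cycles-gap⇒step refl = sym (*-cancelˡ-≡ (b + 1) a 2 (+-cancelˡ-≡ Y _ _ (trans (shift Y b) balanced)))

module _ {N : ℕ} {x y : Perm N} (odd-x : AllCyclesOdd x) (odd-y : AllCyclesOdd y) where

  private
    b₀ a₀ : ℕ
    b₀ = proj₁ (ℓ-allCyclesOdd x odd-x)
    a₀ = proj₁ (ℓ-allCyclesOdd y odd-y)
    ℓ₃x : IsL3 x b₀
    ℓ₃x = proj₁ (proj₂ (ℓ-allCyclesOdd x odd-x))
    ℓ₃y : IsL3 y a₀
    ℓ₃y = proj₁ (proj₂ (ℓ-allCyclesOdd y odd-y))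
    balanced : cycles x + 2 * b₀ ≡ cycles y + 2 * a₀
    balanced = trans (sym (proj₂ (proj₂ (proj₂ (ℓ-allCyclesOdd x odd-x)))))
                     (proj₂ (proj₂ (proj₂ (ℓ-allCyclesOdd y odd-y))))

  covers⇒splitOdd3 : Covers y x → SplitOdd3 x y
  covers⇒splitOdd3 (((a , b , c , ℓy , ℓx , ((ds , ds3 , length≡ , ds≈q) , min-q) , a≡b+c) , x≉y) , cover) =
    by-factors ds ds3 length≡ ds≈q
    where
    oddLength : ∀ {z : Perm N} → AllCyclesOdd z → ∀ i → ∃[ p ] (CycleLen z i p × Odd p)
    oddLength {z} odd i = let p , len = cycleLength z i in p , len , odd i p len
    by-factors : ∀ ds → All IsThreeCycle ds → length ds ≡ c → prod ds ≈ₚ (y ∘ₚ flip x) → SplitOdd3 x y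
    by-factors [] _ _ id≈q = ⊥-elim (x≉y (quotient-id {x = x} {y} id≈q))
    by-factors (d ∷ e ∷ es) (d-cycle ∷ threeCycles) refl prod≈q =
      let z , inA-z , x<z , z<y =
            interpolate {x = x} {y} ℓy ℓx {d} {e} {es} d-cycle threeCycles prod≈q min-q a≡b+c in
      ⊥-elim (cover z inA-z x<z z<y)
    by-factors (d ∷ []) (d-cycle@(u , v , w , _) ∷ []) refl d≈q =
      x ⟨$⟩ʳ u , x ⟨$⟩ʳ v , x ⟨$⟩ʳ w , rotated⇒joinOf3 x rotated apart ,
      oddLength odd-x _ , oddLength odd-x _ , oddLength odd-x _ , oddLength odd-y _
      where
      rotated : Rotated x u v w y
      rotated = rotated-threeCycle {x = x} {y} {d} d-cycle (λ m → trans (cong (x ⟨$⟩ʳ_) (d≈q m)) (inverseʳ x))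
      a₀≡b₀+1 : a₀ ≡ b₀ + 1
      a₀≡b₀+1 = trans (ℓ₃-unique {x = y} ℓ₃y ℓy) (trans a≡b+c (cong (_+ 1) (ℓ₃-unique {x = x} ℓx ℓ₃x)))
      apart : Apart x u v w
      apart = rotate-tight⇒apart rotated (step⇒cycles-gap balanced a₀≡b₀+1)

  splitOdd3⇒covers : SplitOdd3 x y → Covers y x
  splitOdd3⇒covers (a , b , c , join , _) =
    ((a₀ , b₀ , 1 , ℓ₃y , ℓ₃x , ℓ₃q , a₀≡b₀+1) , x≉y) , nothing-between
    where
    u v w : Fin N
    u = flip x ⟨$⟩ʳ a
    v = flip x ⟨$⟩ʳ b
    w = flip x ⟨$⟩ʳ c
    rotated : Rotated x u v w y
    rotated = proj₁ (joinOf3⇒rotated x {y} join)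
    apart : Apart x u v w
    apart = proj₂ (joinOf3⇒rotated x {y} join)
    gap : cycles x ≡ cycles y + 2
    gap = Joined.cycles-join rotated apart (proj₂ (cycleLength x _)) (proj₂ (cycleLength x _)) (proj₂ (cycleLength x _))
    a₀≡b₀+1 : a₀ ≡ b₀ + 1
    a₀≡b₀+1 = cycles-gap⇒step balanced gap
    x≉y : ¬ x ≈ₚ y
    x≉y x≈y = 0≢2 (+-cancelˡ-≡ (cycles y) 0 2 (trans (+-identityʳ (cycles y)) (trans (sym (cycles-≈ x≈y)) gap)))
      where 0≢2 : 0 ≢ 2
            0≢2 ()
    ℓ₃q : IsL3 (y ∘ₚ flip x) 1
    ℓ₃q = ℓ₃-quotient-one {x = x} {y} {threeCycle u v w} (isThreeCycle-threeCycle u≢v v≢w u≢w)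
            (rotated⇒≈ rotated u≢v v≢w u≢w) x≉y
      where
      u≢v : u ≢ v
      u≢v eq = proj₁ apart (0 , eq)
      v≢w : v ≢ w
      v≢w eq = proj₁ (proj₂ apart) (0 , eq)
      u≢w : u ≢ w
      u≢w eq = proj₂ (proj₂ apart) (0 , eq)
    nothing-between : ∀ z → InA z → x <₃ z → ¬ (z <₃ y)
    nothing-between z _ x<z z<y =
      let n , _ , _ , ℓz , _ = proj₁ x<z in
      1+n≰n (≤-trans (s≤s (<₃⇒ℓ₃< {x = x} {z} x<z ℓ₃x ℓz))
                     (subst (suc n ≤_) (trans a₀≡b₀+1 (+-comm b₀ 1)) (<₃⇒ℓ₃< {x = z} {y} z<y ℓz ℓ₃y)))

proposition4p2 : (N : ℕ) →
    ((x y : Perm N) → InA x → InAo y → x ≤₃ y → InAo x)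
    × ((x : Perm N) → InAo x → ∃[ a ] (IsL3 x a × IsL2 x (2 * a)))
    × ((x y : Perm N) → InAo x → InAo y → (Covers y x ⇔ SplitOdd3 x y))
proposition4p2 N =
    (λ x y inA-x (_ , odd-y) x≤y → inA-x , allCyclesOdd-below odd-y x≤y)
  , (λ x (_ , odd) → let a , ℓ₃ , ℓ₂ , _ = ℓ-allCyclesOdd x odd in a , ℓ₃ , ℓ₂)
  , (λ x y (_ , odd-x) (_ , odd-y) → mk⇔ (covers⇒splitOdd3 odd-x odd-y) (splitOdd3⇒covers odd-x odd-y))
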